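{- Consider the auction algorithm described in the context, run on a weighted bipartite graph $G=(U\cup V,E)$ with parameter $\varepsilon>0$, and fix a move $p$. Let $t$ be even with $4\le t\le 2n-4$ and let $B_t=(v_1,u_2,v_2,\dots,u_{t/2+1},v_{t/2+1})$ be an alternating path in $G$ with $v_i\in V$, $u_i\in U$, whose edges $(v_i,u_{i+1})$ are unmatched and whose edges $(u_{i+1},v_{i+1})$ are matched at the end of move $p$ (so the first edge is unmatched). Let $\mathcal{M}_p(B_t)$ and $\mathcal{M}'_p(B_t)$ be the sets of matched and unmatched edges of $B_t$ at the end of move $p$. Then $$L_p(v_{t/2+1})\le L_p(v_1)+\sum_{e\in\mathcal{M}'_p(B_t)}w(e)-\sum_{e\in\mathcal{M}_p(B_t)}w(e)+\frac{t\varepsilon}{2}.$$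
   Context: $G=(U\cup V,E)$ is bipartite with $|U|\le|V|=n$, weights $w:E\to\mathbb{R}$, maximum/minimum edge weights $w^{max},w^{min}$, and $N(u)\subseteq V$ the neighbours of $u\in U$. The algorithm keeps for each $v\in V$ a label $L(v)$ and assigned vertex $T(v)\in U\cup\{\emptyset\}$, initially $L(v)=0$, $T(v)=\emptyset$, and processes each $u\in U$ by MatchVertex$(u)$: (1) choose $v\in N(u)$ minimizing $L(v)+w(u,v)$; (2) if $L(v)>\frac n2(w^{max}-w^{min}+\varepsilon)$, return; (3) set $L(v)\leftarrow \min_{v'\in N(u)\setminus\{v\}}(L(v')+w(u,v'))-w(u,v)+\varepsilon$; (4) if $T(v)=y\ne\emptyset$, set $T(v)\leftarrow u$ and call MatchVertex$(y)$, else set $T(v)\leftarrow u$. A move is an assignment of an edge $(u,v)$ to $v$. $L_p(v)$ is the label of $v$ at the end of the $p$-th move; the matched edges at the end of move $p$ are $\{(T(v),v):T(v)\ne\emptyset\}$.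
   Formalization: The edge weights and the parameter ε are rational rather than real, so the labels L(v) take values in the rationals extended by +∞. -}

module Defs where

open import Data.Nat as ℕ using (ℕ; zero; suc)
open import Data.Integer using (+_)
open import Data.Rational as ℚ using (ℚ; _+_; _-_; _*_; _/_; 0ℚ)
open import Data.Fin as Fin using (Fin)
open import Data.Maybe using (Maybe; just; nothing)
open import Data.List using (List; _∷_; allFin)
open import Data.List.Relation.Binary.Permutation.Propositional using (_↭_)
open import Data.Product using (Σ; ∃; _×_; _,_)
open import Data.Sum using (_⊎_)
open import Relation.Nullary using (¬_; does)
open import Relation.Binary.PropositionalEquality using (_≡_; _≢_)
open import Data.Bool using (if_then_else_)

-- Labels: rationals extended with +∞ (the min over an empty set in step (3)).
data ℚ∞ : Set where
  fin : ℚ → ℚ∞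
  ∞   : ℚ∞

infixl 6 _⊕_
_⊕_ : ℚ∞ → ℚ → ℚ∞
fin p ⊕ q = fin (p + q)
∞     ⊕ q = ∞

infix 4 _≤∞_ _>∞_
data _≤∞_ : ℚ∞ → ℚ∞ → Set where
  fin≤fin : ∀ {p q} → p ℚ.≤ q → fin p ≤∞ fin q
  x≤∞     : ∀ {x} → x ≤∞ ∞

data _>∞_ : ℚ∞ → ℚ → Set where
  fin> : ∀ {p q} → q ℚ.< p → fin p >∞ q
  ∞>   : ∀ {q} → ∞ >∞ q

sumFin : (k : ℕ) → (Fin k → ℚ) → ℚ
sumFin zero    f = 0ℚ
sumFin (suc k) f = f Fin.zero + sumFin k (λ i → f (Fin.suc i))

IsMaxWeight : {m n : ℕ} → (Fin m → Fin n → Set) → (Fin m → Fin n → ℚ) → ℚ → Set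
IsMaxWeight {m} {n} E w x =
  (∀ u v → E u v → w u v ℚ.≤ x) × Σ (Fin m) λ u → Σ (Fin n) λ v → E u v × w u v ≡ x

IsMinWeight : {m n : ℕ} → (Fin m → Fin n → Set) → (Fin m → Fin n → ℚ) → ℚ → Set
IsMinWeight {m} {n} E w x =
  (∀ u v → E u v → x ℚ.≤ w u v) × Σ (Fin m) λ u → Σ (Fin n) λ v → E u v × w u v ≡ x

module Auction {m n : ℕ} (E : Fin m → Fin n → Set) (w : Fin m → Fin n → ℚ)
               (ε wmax wmin : ℚ) where

  record Config : Set where
    constructor config
    field
      L       : Fin n → ℚ∞
      T       : Fin n → Maybe (Fin m)
      active  : Maybe (Fin m)         -- vertex whose MatchVertex call is running
      pending : List (Fin m)
  open Config public

  threshold : ℚ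
  threshold = ((+ n) / 2) * (wmax - wmin + ε)

  upd : {A : Set} → (Fin n → A) → Fin n → A → Fin n → A
  upd f v a v' = if does (v' Fin.≟ v) then a else f v'

  ArgMin : (Fin n → ℚ∞) → Fin m → Fin n → Set
  ArgMin L u v = E u v × (∀ v' → E u v' → L v ⊕ w u v ≤∞ L v' ⊕ w u v')

  MinOthers : (Fin n → ℚ∞) → Fin m → Fin n → ℚ∞ → Set
  MinOthers L u v x =
    ((∀ v' → E u v' → v' ≡ v) × x ≡ ∞)
    ⊎ Σ (Fin n) λ v' → v' ≢ v × E u v'
        × (∀ v'' → E u v'' → v'' ≢ v → L v' ⊕ w u v' ≤∞ L v'' ⊕ w u v'')
        × x ≡ L v' ⊕ w u v'

  data Silent : Config → Config → Set where
    start  : ∀ {L T u us} → Silent (config L T nothing (u ∷ us)) (config L T (just u) us)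
    noNbr  : ∀ {L T u ps} → (∀ v → ¬ E u v) →
             Silent (config L T (just u) ps) (config L T nothing ps)
    stop   : ∀ {L T u ps v} → ArgMin L u v → L v >∞ threshold →
             Silent (config L T (just u) ps) (config L T nothing ps)

  -- a move: steps (1),(2 not returning),(3),(4); the call continues with the evicted vertex
  data Move : Config → Config → Set where
    move : ∀ {L T u ps v x} → ArgMin L u v → ¬ (L v >∞ threshold) → MinOthers L u v x →
           Move (config L T (just u) ps)
                (config (upd L v (x ⊕ (ε - w u v))) (upd T v (just u)) (T v) ps)

  initial : List (Fin m) → Config
  initial ord = config (λ _ → fin 0ℚ) (λ _ → nothing) nothing ord

  -- Reach ord p c : c is a configuration reachable from the start, after exactly p moves,
  -- when U is processed in the order ord.  (L,T) of c are L_p, T_p.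
  data Reach (ord : List (Fin m)) : ℕ → Config → Set where
    init   : Reach ord 0 (initial ord)
    silent : ∀ {p c c'} → Reach ord p c → Silent c c' → Reach ord p c'
    moved  : ∀ {p c c'} → Reach ord p c → Move c c' → Reach ord (suc p) c'

{-# OPTIONS --safe #-}
module Submission where

-- Every move preserves ε-complementary slackness: if T(v) = u then
-- L(v) + w(u,v) ≤ L(v') + w(u,v') + ε for every other neighbour v' of u. The new label of v is
-- set from u's second-best offer, which gives the inequality for the new pair, and labels never
-- decrease, which keeps it for the old pairs. Along the path, the matched edge (u_{i+1}, v_{i+1})
-- compared with the neighbour v_i gives L(v_{i+1}) ≤ L(v_i) + w(u_{i+1}, v_i) - w(u_{i+1}, v_{i+1}) + ε,
-- and these k = t/2 inequalities telescope.

open import Defs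
open import Data.Nat as ℕ using (ℕ; suc; _≤_; _∸_)
open import Data.Integer using (+_)
open import Data.Rational as ℚ using (ℚ; 0ℚ; 1ℚ; _/_; _*_; _-_; _+_; -_)
open import Data.Fin as Fin using (Fin; inject₁; fromℕ)
open import Data.Maybe using (Maybe; just)
open import Data.List using (List; allFin)
open import Data.List.Relation.Binary.Permutation.Propositional using (_↭_)
open import Data.Product using (_,_)
open import Data.Sum using (inj₁; inj₂)
open import Function.Base using (_∘_)
open import Function.Definitions using (Injective)
open import Relation.Binary.PropositionalEquality
  using (_≡_; _≢_; refl; sym; trans; cong; cong₂; subst; isEquivalence; module ≡-Reasoning)
open import Level using (0ℓ)
open import Relation.Binary.Bundles using (Preorder)
import Relation.Binary.Reasoning.Preorder as PreorderReasoning
open import Relation.Nullary using (Dec; yes; no; contradiction)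
import Data.Rational.Properties as ℚ
import Data.Rational.Unnormalised as ℚᵘ
import Data.Rational.Unnormalised.Properties as ℚᵘ
import Data.Fin.Properties as Fin
open import Data.Rational.Solver using (module +-*-Solver)
import Data.Integer as ℤ
import Data.Integer.Properties as ℤ

≤∞-refl : ∀ {x} → x ≤∞ x
≤∞-refl {fin p} = fin≤fin ℚ.≤-refl
≤∞-refl {∞}     = x≤∞

≤∞-trans : ∀ {x y z} → x ≤∞ y → y ≤∞ z → x ≤∞ z
≤∞-trans (fin≤fin p≤q) (fin≤fin q≤r) = fin≤fin (ℚ.≤-trans p≤q q≤r)
≤∞-trans _             x≤∞           = x≤∞

≤∞-preorder : Preorder 0ℓ 0ℓ 0ℓ
≤∞-preorder = record
  { Carrier    = ℚ∞
  ; _≈_        = _≡_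
  ; _≲_        = _≤∞_
  ; isPreorder = record
    { isEquivalence = isEquivalence
    ; reflexive     = λ { refl → ≤∞-refl }
    ; trans         = ≤∞-trans
    }
  }

module ≤∞-Reasoning = PreorderReasoning ≤∞-preorder

⊕-assoc : ∀ x p q → x ⊕ p ⊕ q ≡ x ⊕ (p + q)
⊕-assoc (fin r) p q = cong fin (ℚ.+-assoc r p q)
⊕-assoc ∞       p q = refl

⊕-identityʳ : ∀ x → x ⊕ 0ℚ ≡ x
⊕-identityʳ (fin p) = cong fin (ℚ.+-identityʳ p)
⊕-identityʳ ∞       = refl

⊕-monoˡ-≤∞ : ∀ {x y} p → x ≤∞ y → x ⊕ p ≤∞ y ⊕ p
⊕-monoˡ-≤∞ p (fin≤fin q≤r) = fin≤fin (ℚ.+-monoˡ-≤ p q≤r)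
⊕-monoˡ-≤∞ p x≤∞           = x≤∞

⊕-monoʳ-≤∞ : ∀ x {p q} → p ℚ.≤ q → x ⊕ p ≤∞ x ⊕ q
⊕-monoʳ-≤∞ (fin r) p≤q = fin≤fin (ℚ.+-monoʳ-≤ r p≤q)
⊕-monoʳ-≤∞ ∞       p≤q = x≤∞

x⊕p≤∞y⊕q⇒x≤∞y⊕[q-p] : ∀ {x y} p q → x ⊕ p ≤∞ y ⊕ q → x ≤∞ y ⊕ (q - p)
x⊕p≤∞y⊕q⇒x≤∞y⊕[q-p] {x} {y} p q x⊕p≤y⊕q = begin
  x              ≡⟨ sym (⊕-identityʳ x) ⟩
  x ⊕ 0ℚ         ≡⟨ cong (x ⊕_) (sym (ℚ.+-inverseʳ p)) ⟩
  x ⊕ (p - p)    ≡⟨ sym (⊕-assoc x p (- p)) ⟩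
  x ⊕ p ⊕ (- p)  ≲⟨ ⊕-monoˡ-≤∞ (- p) x⊕p≤y⊕q ⟩
  y ⊕ q ⊕ (- p)  ≡⟨ ⊕-assoc y q (- p) ⟩
  y ⊕ (q - p)    ∎
  where open ≤∞-Reasoning

fromℚᵘ-homo-+ : ∀ p q → ℚ.fromℚᵘ (p ℚᵘ.+ q) ≡ ℚ.fromℚᵘ p + ℚ.fromℚᵘ q
fromℚᵘ-homo-+ p q = ℚ.toℚᵘ-injective (begin-equality
  ℚ.toℚᵘ (ℚ.fromℚᵘ (p ℚᵘ.+ q))                          ≃⟨ ℚ.toℚᵘ-fromℚᵘ (p ℚᵘ.+ q) ⟩
  p ℚᵘ.+ q                                              ≃⟨ ℚᵘ.+-cong (ℚᵘ.≃-sym (ℚ.toℚᵘ-fromℚᵘ p)) (ℚᵘ.≃-sym (ℚ.toℚᵘ-fromℚᵘ q)) ⟩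
  ℚ.toℚᵘ (ℚ.fromℚᵘ p) ℚᵘ.+ ℚ.toℚᵘ (ℚ.fromℚᵘ q)          ≃⟨ ℚ.toℚᵘ-homo-+ (ℚ.fromℚᵘ p) (ℚ.fromℚᵘ q) ⟨
  ℚ.toℚᵘ (ℚ.fromℚᵘ p + ℚ.fromℚᵘ q)                      ∎)
  where open ℚᵘ.≤-Reasoning

[1+k]/1≡1+k/1 : ∀ k → + suc k / 1 ≡ 1ℚ + + k / 1
[1+k]/1≡1+k/1 k = begin
  ℚ.fromℚᵘ (ℚᵘ.mkℚᵘ (+ suc k) 0)           ≡⟨ ℚ.fromℚᵘ-cong {ℚᵘ.mkℚᵘ (+ suc k) 0} k+1≃1+k ⟩
  ℚ.fromℚᵘ (ℚᵘ.1ℚᵘ ℚᵘ.+ ℚᵘ.mkℚᵘ (+ k) 0)  ≡⟨ fromℚᵘ-homo-+ ℚᵘ.1ℚᵘ (ℚᵘ.mkℚᵘ (+ k) 0) ⟩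
  1ℚ + + k / 1                             ∎
  where
  open ≡-Reasoning
  k+1≃1+k : ℚᵘ.mkℚᵘ (+ suc k) 0 ℚᵘ.≃ ℚᵘ.1ℚᵘ ℚᵘ.+ ℚᵘ.mkℚᵘ (+ k) 0
  k+1≃1+k = ℚᵘ.*≡* (cong (ℤ._* + 1) (cong (ℤ._+_ ℤ.1ℤ) (sym (ℤ.*-identityʳ (+ k)))))

[2*k]/2≡k/1 : ∀ k → + (2 ℕ.* k) / 2 ≡ + k / 1
[2*k]/2≡k/1 k = ℚ.fromℚᵘ-cong {ℚᵘ.mkℚᵘ (+ (2 ℕ.* k)) 1} {ℚᵘ.mkℚᵘ (+ k) 0} (ℚᵘ.*≡* (begin
  + (2 ℕ.* k) ℤ.* + 1  ≡⟨ ℤ.*-identityʳ (+ (2 ℕ.* k)) ⟩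
  + (2 ℕ.* k)          ≡⟨ ℤ.pos-* 2 k ⟩
  + 2 ℤ.* + k          ≡⟨ ℤ.*-comm (+ 2) (+ k) ⟩
  + k ℤ.* + 2          ∎))
  where open ≡-Reasoning

sumFin-const : ∀ k c → sumFin k (λ _ → c) ≡ (+ k / 1) * c
sumFin-const ℕ.zero    c = sym (ℚ.*-zeroˡ c)
sumFin-const (suc k) c = begin
  c + sumFin k (λ _ → c)  ≡⟨ cong (_+_ c) (sumFin-const k c) ⟩
  c + (+ k / 1) * c       ≡⟨ solve 2 (λ c x → c :+ x :* c := (con 1ℚ :+ x) :* c) refl c (+ k / 1) ⟩
  (1ℚ + + k / 1) * c      ≡⟨ cong (_* c) ([1+k]/1≡1+k/1 k) ⟨
  (+ suc k / 1) * c       ∎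
  where
  open ≡-Reasoning
  open +-*-Solver

sumFin-+ : ∀ k (f g : Fin k → ℚ) → sumFin k (λ i → f i + g i) ≡ sumFin k f + sumFin k g
sumFin-+ ℕ.zero    f g = refl
sumFin-+ (suc k) f g = begin
  f₀ + g₀ + sumFin k (λ i → f (Fin.suc i) + g (Fin.suc i))  ≡⟨ cong (_+_ (f₀ + g₀)) (sumFin-+ k (f ∘ Fin.suc) (g ∘ Fin.suc)) ⟩
  f₀ + g₀ + (F + G)                                           ≡⟨ solve 4 (λ a b x y → a :+ b :+ (x :+ y) := a :+ x :+ (b :+ y)) refl f₀ g₀ F G ⟩
  f₀ + F + (g₀ + G)                                           ∎
  where
  open ≡-Reasoning
  open +-*-Solver
  f₀ = f Fin.zero
  g₀ = g Fin.zero
  F = sumFin k (f ∘ Fin.suc)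
  G = sumFin k (g ∘ Fin.suc)

sumFin-neg : ∀ k (f : Fin k → ℚ) → sumFin k (λ i → - f i) ≡ - sumFin k f
sumFin-neg ℕ.zero    f = refl
sumFin-neg (suc k) f = begin
  - f Fin.zero + sumFin k (λ i → - f (Fin.suc i))  ≡⟨ cong (_+_ (- f Fin.zero)) (sumFin-neg k (f ∘ Fin.suc)) ⟩
  - f Fin.zero + - sumFin k (f ∘ Fin.suc)          ≡⟨ ℚ.neg-distrib-+ (f Fin.zero) (sumFin k (f ∘ Fin.suc)) ⟨
  - (f Fin.zero + sumFin k (f ∘ Fin.suc))          ∎
  where open ≡-Reasoning

telescope : ∀ k (ℓ : Fin (suc k) → ℚ∞) (d : Fin k → ℚ) →
            (∀ i → ℓ (Fin.suc i) ≤∞ ℓ (inject₁ i) ⊕ d i) →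
            ℓ (fromℕ k) ≤∞ ℓ Fin.zero ⊕ sumFin k d
telescope ℕ.zero    ℓ d step = subst (ℓ Fin.zero ≤∞_) (sym (⊕-identityʳ (ℓ Fin.zero))) ≤∞-refl
telescope (suc k) ℓ d step = begin
  ℓ (fromℕ (suc k))                                 ≲⟨ telescope k (ℓ ∘ Fin.suc) (d ∘ Fin.suc) (step ∘ Fin.suc) ⟩
  ℓ (Fin.suc Fin.zero) ⊕ sumFin k (d ∘ Fin.suc)     ≲⟨ ⊕-monoˡ-≤∞ _ (step Fin.zero) ⟩
  ℓ Fin.zero ⊕ d Fin.zero ⊕ sumFin k (d ∘ Fin.suc)  ≡⟨ ⊕-assoc (ℓ Fin.zero) (d Fin.zero) _ ⟩
  ℓ Fin.zero ⊕ sumFin (suc k) d                     ∎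
  where open ≤∞-Reasoning

inject₁≢suc : ∀ {k} (i : Fin k) → inject₁ i ≢ Fin.suc i
inject₁≢suc Fin.zero    ()
inject₁≢suc (Fin.suc i) eq = inject₁≢suc i (Fin.suc-injective eq)

module ε-ComplementarySlackness {m n : ℕ} (E : Fin m → Fin n → Set) (w : Fin m → Fin n → ℚ)
                                (ε wmax wmin : ℚ) (0≤ε : 0ℚ ℚ.≤ ε) where
  open Auction E w ε wmax wmin

  upd-same : ∀ {A : Set} (f : Fin n → A) v a → upd f v a v ≡ a
  upd-same f v a with v Fin.≟ v
  ... | yes _  = refl
  ... | no v≢v = contradiction refl v≢v

  upd-other : ∀ {A : Set} (f : Fin n → A) v a {v'} → v' ≢ v → upd f v a v' ≡ f v'
  upd-other f v a {v'} v'≢v with v' Fin.≟ v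
  ... | yes v'≡v = contradiction v'≡v v'≢v
  ... | no _     = refl

  ε-CS : (Fin n → ℚ∞) → (Fin n → Maybe (Fin m)) → Set
  ε-CS L T = ∀ v u → T v ≡ just u → ∀ v' → v' ≢ v → E u v' → L v ⊕ w u v ≤∞ L v' ⊕ (w u v' + ε)

  MinOthers-≤ : ∀ {L u v x} → MinOthers L u v x → ∀ {v'} → v' ≢ v → E u v' → x ≤∞ L v' ⊕ w u v'
  MinOthers-≤ (inj₁ (N[u]⊆v , _))                 v'≢v Euv' = contradiction (N[u]⊆v _ Euv') v'≢v
  MinOthers-≤ (inj₂ (_ , _ , _ , minimal , refl)) v'≢v Euv' = minimal _ Euv' v'≢v

  ArgMin-≤-MinOthers : ∀ {L u v x} → ArgMin L u v → MinOthers L u v x → L v ⊕ w u v ≤∞ x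
  ArgMin-≤-MinOthers _           (inj₁ (_ , refl))                 = x≤∞
  ArgMin-≤-MinOthers (_ , least) (inj₂ (v₀ , _ , Euv₀ , _ , refl)) = least v₀ Euv₀

  move-raises-label : ∀ {L u v x} → ArgMin L u v → MinOthers L u v x → L v ≤∞ x ⊕ (ε - w u v)
  move-raises-label {L} {u} {v} {x} am mo = begin
    L v                          ≡⟨ ⊕-identityʳ (L v) ⟨
    L v ⊕ 0ℚ                     ≲⟨ ⊕-monoʳ-≤∞ (L v) 0≤ε ⟩
    L v ⊕ ε                      ≡⟨ cong (L v ⊕_) (solve 2 (λ a e → e := a :+ (e :- a)) refl (w u v) ε) ⟩
    L v ⊕ (w u v + (ε - w u v))  ≡⟨ ⊕-assoc (L v) (w u v) (ε - w u v) ⟨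
    L v ⊕ w u v ⊕ (ε - w u v)    ≲⟨ ⊕-monoˡ-≤∞ (ε - w u v) (ArgMin-≤-MinOthers am mo) ⟩
    x ⊕ (ε - w u v)              ∎
    where
    open ≤∞-Reasoning
    open +-*-Solver

  move-establishes-ε-CS : ∀ {L u v x} → MinOthers L u v x → ∀ {v'} → v' ≢ v → E u v' →
                          x ⊕ (ε - w u v) ⊕ w u v ≤∞ L v' ⊕ (w u v' + ε)
  move-establishes-ε-CS {L} {u} {v} {x} mo {v'} v'≢v Euv' = begin
    x ⊕ (ε - w u v) ⊕ w u v    ≡⟨ ⊕-assoc x (ε - w u v) (w u v) ⟩
    x ⊕ (ε - w u v + w u v)    ≡⟨ cong (x ⊕_) (solve 2 (λ a e → e :- a :+ a := e) refl (w u v) ε) ⟩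
    x ⊕ ε                      ≲⟨ ⊕-monoˡ-≤∞ ε (MinOthers-≤ mo v'≢v Euv') ⟩
    L v' ⊕ w u v' ⊕ ε          ≡⟨ ⊕-assoc (L v') (w u v') ε ⟩
    L v' ⊕ (w u v' + ε)        ∎
    where
    open ≤∞-Reasoning
    open +-*-Solver

  move-preserves-ε-CS : ∀ {L T u v x} → ε-CS L T → ArgMin L u v → MinOthers L u v x →
                        ε-CS (upd L v (x ⊕ (ε - w u v))) (upd T v (just u))
  move-preserves-ε-CS {L} {T} {u} {v} {x} cs am mo a b T'a≡b a' a'≢a Eba' =
    by-cases (a Fin.≟ v) (a' Fin.≟ v)
    where
    L' = upd L v (x ⊕ (ε - w u v))

    by-cases : Dec (a ≡ v) → Dec (a' ≡ v) → L' a ⊕ w b a ≤∞ L' a' ⊕ (w b a' + ε)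
    by-cases (yes refl) _
      with refl ← trans (sym (upd-same T a (just u))) T'a≡b
      rewrite upd-same L a (x ⊕ (ε - w u a)) | upd-other L a (x ⊕ (ε - w u a)) a'≢a
      = move-establishes-ε-CS mo a'≢a Eba'
    by-cases (no a≢v) (yes refl)
      rewrite upd-other L a' (x ⊕ (ε - w u a')) a≢v | upd-same L a' (x ⊕ (ε - w u a'))
      = ≤∞-trans (cs a b (trans (sym (upd-other T a' (just u) a≢v)) T'a≡b) a' a'≢a Eba')
                 (⊕-monoˡ-≤∞ (w b a' + ε) (move-raises-label am mo))
    by-cases (no a≢v) (no a'≢v)
      rewrite upd-other L v (x ⊕ (ε - w u v)) a≢v | upd-other L v (x ⊕ (ε - w u v)) a'≢v
      = cs a b (trans (sym (upd-other T v (just u) a≢v)) T'a≡b) a' a'≢a Eba'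

  reachable⇒ε-CS : ∀ {ord p c} → Reach ord p c → ε-CS (L c) (T c)
  reachable⇒ε-CS init                     _ _ ()
  reachable⇒ε-CS (silent r start)         = reachable⇒ε-CS r
  reachable⇒ε-CS (silent r (noNbr _))     = reachable⇒ε-CS r
  reachable⇒ε-CS (silent r (stop _ _))    = reachable⇒ε-CS r
  reachable⇒ε-CS (moved r (move am _ mo)) = move-preserves-ε-CS (reachable⇒ε-CS r) am mo

  ε-CS⇒label-step : ∀ {L T u v v'} → ε-CS L T → T v ≡ just u → v' ≢ v → E u v' →
                    L v ≤∞ L v' ⊕ (w u v' - w u v + ε)
  ε-CS⇒label-step {L} {T} {u} {v} {v'} cs Tv≡u v'≢v Euv' =
    subst (λ q → L v ≤∞ L v' ⊕ q)
          (solve 3 (λ a a' e → a' :+ e :- a := a' :- a :+ e) refl (w u v) (w u v') ε)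
          (x⊕p≤∞y⊕q⇒x≤∞y⊕[q-p] (w u v) (w u v' + ε) (cs v u Tv≡u v' v'≢v Euv'))
    where open +-*-Solver

alternating-path-weight : ∀ k (a b : Fin k → ℚ) ε →
  sumFin k (λ i → a i - b i + ε) ≡ sumFin k a - sumFin k b + (+ (2 ℕ.* k) / 2) * ε
alternating-path-weight k a b ε = begin
  sumFin k (λ i → a i - b i + ε)                      ≡⟨ sumFin-+ k (λ i → a i - b i) (λ _ → ε) ⟩
  sumFin k (λ i → a i - b i) + sumFin k (λ _ → ε)     ≡⟨ cong₂ _+_ (sumFin-+ k a (λ i → - b i)) (sumFin-const k ε) ⟩
  sumFin k a + sumFin k (λ i → - b i) + (+ k / 1) * ε ≡⟨ cong₂ (λ B c → sumFin k a + B + c * ε) (sumFin-neg k b) (sym ([2*k]/2≡k/1 k)) ⟩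
  sumFin k a - sumFin k b + (+ (2 ℕ.* k) / 2) * ε      ∎
  where open ≡-Reasoning

lemma1 : (m n : ℕ) → m ≤ n → (E : Fin m → Fin n → Set) → (w : Fin m → Fin n → ℚ)
    → (ε wmax wmin : ℚ) → 0ℚ ℚ.< ε → IsMaxWeight E w wmax → IsMinWeight E w wmin
    → (ord : List (Fin m)) → ord ↭ allFin m
    → (p : ℕ) → (c : Auction.Config E w ε wmax wmin) → Auction.Reach E w ε wmax wmin ord p c
    → (t k : ℕ) → t ≡ 2 ℕ.* k → 4 ≤ t → t ≤ 2 ℕ.* n ∸ 4
    → (vs : Fin (suc k) → Fin n) → (us : Fin k → Fin m)
    → Injective _≡_ _≡_ vs → Injective _≡_ _≡_ us
    → (∀ i → E (us i) (vs (inject₁ i)))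
    → (∀ i → Auction.T c (vs (inject₁ i)) ≢ just (us i))
    → (∀ i → E (us i) (vs (Fin.suc i)))
    → (∀ i → Auction.T c (vs (Fin.suc i)) ≡ just (us i))
    → Auction.L c (vs (fromℕ k))
      ≤∞ Auction.L c (vs Fin.zero)
         ⊕ (sumFin k (λ i → w (us i) (vs (inject₁ i)))
            - sumFin k (λ i → w (us i) (vs (Fin.suc i)))
            + ((+ t) / 2) * ε)
lemma1 _ _ _ E w ε wmax wmin 0<ε _ _ _ _ _ c reach .(2 ℕ.* k) k refl _ _ vs us vs-inj _
       E[u,v-] _ _ T[v+]≡u =
  subst (λ s → L c (vs (fromℕ k)) ≤∞ L c (vs Fin.zero) ⊕ s)
        (alternating-path-weight k unmatched matched ε)
        (telescope k (L c ∘ vs) (λ i → unmatched i - matched i + ε) step)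
  where
  open Auction E w ε wmax wmin
  open ε-ComplementarySlackness E w ε wmax wmin (ℚ.<⇒≤ 0<ε)

  unmatched matched : Fin k → ℚ
  unmatched i = w (us i) (vs (inject₁ i))
  matched   i = w (us i) (vs (Fin.suc i))

  step : ∀ i → L c (vs (Fin.suc i)) ≤∞ L c (vs (inject₁ i)) ⊕ (unmatched i - matched i + ε)
  step i = ε-CS⇒label-step (reachable⇒ε-CS reach) (T[v+]≡u i) (inject₁≢suc i ∘ vs-inj) (E[u,v-] i)
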